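{- There is a countable adequate partial semigroup $(S,*)$ such that $S$ is not a $1$-CR set in $S$. In particular, since $S$ is a piecewise syndetic subset of itself, a piecewise syndetic set in an adequate partial semigroup need not be a $1$-CR set (and hence need not be a CR set).
   Context: A partial semigroup is a pair $(S,*)$ where $S$ is a nonempty set and $*$ is an operation defined on a nonempty subset of $S\times S$ such that for all $x,y,z\in S$, $(x*y)*z=x*(y*z)$ in the sense that if either side is defined then so is the other and they are equal. For $a\in S$, $\varphi(a)=\{b\in S: a*b \text{ is defined}\}$; for finite nonempty $F\subseteq S$, $\sigma(F)=\bigcap_{a\in F}\varphi(a)$. $(S,*)$ is adequate if $\sigma(F)\neq\emptyset$ for all finite nonempty $F$. $\mathcal{P}_f(X)$ denotes the set of finite nonempty subsets of $X$. Products $\prod_{t\in H}f(t)$ are computed in increasing order of indices. A sequence $f:\mathbb{N}\to S$ is adequate if (i) for each $H\in\mathcal{P}_f(\mathbb{N})$, $\prod_{t\in H}f(t)$ is defined, and (ii) for each $F\in\mathcal{P}_f(S)$ there is $m\in\mathbb{N}$ such that $\prod_{t\in H}f(t)\in\sigma(F)$ for all $H\in\mathcal{P}_f(\mathbb{N})$ with $\min H\geq m$. $\mathcal{T}$ denotes the set of adequate sequences, and $\mathcal{P}_f(\mathcal{T})_{\leq k}=\{F\in\mathcal{P}_f(\mathcal{T}): |F|\leq k\}$. For $k\in\mathbb{N}$, $A\subseteq S$ is a $k$-CR set if for every $L\in\mathcal{P}_f(S)$ there is $r\in\mathbb{N}$ such that for every $F\in\mathcal{P}_f(\mathcal{T})_{\leq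 k}$ there exist $m\in\mathbb{N}$, $a\in S^{m+1}$ and $t(1)<\dots<t(m)\leq r$ in $\mathbb{N}$ such that for all $f\in F$, $a(1)*f(t(1))*a(2)*\dots*a(m)*f(t(m))*a(m+1)$ is defined and lies in $A\cap\sigma(L)$. $A$ is a CR set if it is a $k$-CR set for every $k$. With $\beta S$ the set of ultrafilters on $S$, $\overline{A}=\{p\in\beta S:A\in p\}$, $\delta S=\bigcap_{F\in\mathcal{P}_f(S)}\overline{\sigma(F)}$, $x^{ -1}A=\{y\in\varphi(x):x*y\in A\}$, and $p*q=\{A: \{x: x^{ -1}A\in q\}\in p\}$ for $p,q\in\delta S$, $\delta S$ is a compact right topological semigroup with smallest ideal $K(\delta S)$; $A$ is piecewise syndetic if $\overline{A}\cap K(\delta S)\neq\emptyset$. -}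

module Defs where

open import Data.Nat using (ℕ; zero; suc; _≤_; _<_)
open import Data.Maybe using (Maybe; just; nothing; _>>=_)
open import Data.List using (List; []; _∷_; map; length)
open import Data.List.NonEmpty using (List⁺; toList)
open import Data.List.Relation.Unary.All using (All)
open import Data.List.Relation.Unary.Linked using (Linked)
open import Data.Vec using (Vec; []; _∷_)
import Data.Vec as Vec
open import Data.Product using (Σ; ∃; ∃₂; _×_; _,_)
open import Relation.Binary.PropositionalEquality using (_≡_)
open import Function.Definitions using (Injective)

Defined : {A : Set} → Maybe A → Set
Defined {A} m = Σ A λ v → m ≡ just v

-- Associativity in the strong sense: (x*y)*z is defined iff x*(y*z) is,
-- and then they are equal (both sides `nothing` otherwise).
record PartialSemigroup : Set₁ where
  field
    Carrier : Set
    _*_     : Carrier → Carrier → Maybe Carrier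
    somewhere-defined : ∃₂ λ x y → Defined (x * y)
    assoc   : ∀ x y z → (x * y >>= λ u → u * z) ≡ (y * z >>= λ v → x * v)

module _ (P : PartialSemigroup) where
  open PartialSemigroup P

  Countable : Set
  Countable = Σ (Carrier → ℕ) λ g → Injective _≡_ _≡_ g

  _∈φ_ : Carrier → Carrier → Set
  b ∈φ a = Defined (a * b)

  _∈σ_ : Carrier → List⁺ Carrier → Set
  b ∈σ F = All (λ a → b ∈φ a) (toList F)

  IsAdequate : Set
  IsAdequate = (F : List⁺ Carrier) → Σ Carrier λ b → b ∈σ F

  prod : List Carrier → Maybe Carrier
  prod []           = nothing
  prod (x ∷ [])     = just x
  prod (x ∷ y ∷ ys) = prod (y ∷ ys) >>= λ v → x * v

  -- finite nonempty subsets H of ℕ, represented as strictly increasing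
  -- nonempty lists (so products are taken in increasing order of indices)
  record FinSubsetℕ : Set where
    constructor fin
    field
      elems      : List ℕ
      nonEmpty   : 1 ≤ length elems
      increasing : Linked _<_ elems
  open FinSubsetℕ public

  ∏ : FinSubsetℕ → (ℕ → Carrier) → Maybe Carrier
  ∏ H f = prod (map f (elems H))

  IsAdequateSeq : (ℕ → Carrier) → Set
  IsAdequateSeq f =
    ((H : FinSubsetℕ) → Defined (∏ H f)) ×
    ((F : List⁺ Carrier) → Σ ℕ λ m → (H : FinSubsetℕ) → All (m ≤_) (elems H) →
       Σ Carrier λ v → (∏ H f ≡ just v) × (v ∈σ F))

  word : ∀ {m} → Vec Carrier (suc m) → Vec ℕ m → (ℕ → Carrier) → List Carrier
  word (a ∷ []) [] f = a ∷ []
  word (a ∷ as@(_ ∷ _)) (t ∷ ts) f = a ∷ f t ∷ word as ts f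

  -- k-CR set (a finite set F of at most k adequate sequences is given as a
  -- nonempty list of length ≤ k; repetitions are harmless)
  IsKCR : ℕ → (Carrier → Set) → Set
  IsKCR k A =
    (L : List⁺ Carrier) → Σ ℕ λ r →
      (F : List (ℕ → Carrier)) → 1 ≤ length F → length F ≤ k → All IsAdequateSeq F →
        Σ ℕ λ m → 1 ≤ m × Σ (Vec Carrier (suc m)) λ a → Σ (Vec ℕ m) λ t →
          Linked _<_ (Vec.toList t) × All (_≤ r) (Vec.toList t) ×
          All (λ f → Σ Carrier λ v → (prod (word a t f) ≡ just v) × A v × (v ∈σ L)) F

{-# OPTIONS --safe #-}
module Submission where

-- Take the intervals of ℤ, where x * y is the concatenation [start x, end y],
-- defined when x ends strictly before y starts. Any interval starting to the
-- right of finitely many intervals can follow each of them, which gives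
-- adequacy. Let L = {[0,0]}, so that every element of σ(L) starts right of 0.
-- For each r the sequence t ↦ [t − r, t − r] is adequate, as it eventually
-- moves past any finite set; but a product a(1) * f(t(1)) * ⋯ starts no later
-- than a(1) ends, hence left of t(1) − r, which is ≤ 0 whenever t(1) ≤ r.

open import Defs
open import Data.Product as Product using (Σ; _×_; _,_; proj₁; proj₂)
open import Data.Unit using (⊤)
open import Data.Nat as ℕ using (ℕ; zero; suc; z≤n; s≤s)
open import Data.Nat.Properties as ℕ using (m+n≤o⇒n≤o; m+n≤o⇒m≤o∸n; n∸n≡0; m≤m+n; m+n∸m≡n)
open import Data.Integer using (ℤ; +_; -[1+_]; 0ℤ; _⊔_; _⊖_; ∣_∣; _≤_; _<_; +≤+; +<+; -<+)
open import Data.Integer.Properties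
  using (_<?_; i≤i⊔j; ⊔-idem; i≤j⇒i⊔j≡j; <⇒≤; <-≤-trans; ≤-<-trans; <-asym; ≤-refl;
         ⊖-≥; ⊖-monoˡ-<; ⊖-monoˡ-≤; n⊖n≡0; module ≤-Reasoning)
open import Data.Maybe using (Maybe; just; nothing; _>>=_)
open import Data.List using (List; []; _∷_; map; foldr)
open import Data.List.NonEmpty using (List⁺; toList; _∷_)
open import Data.List.Relation.Unary.All as All using (All; []; _∷_)
open import Data.List.Relation.Unary.Linked as Linked using (Linked; [-]; _∷_)
open import Data.List.Relation.Unary.Linked.Properties using (map⁺)
open import Data.Vec using (_∷_)
open import Function using (_∘_)
open import Function.Consequences.Propositional
  using (inverseʳ⇒injective; strictlyInverseʳ⇒inverseʳ)
open import Relation.Nullary using (¬_; yes; no; contradiction)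
open import Relation.Binary.PropositionalEquality
  using (_≡_; refl; sym; trans; cong; cong₂; subst; module ≡-Reasoning)

m∸n≡1+m∸1+n : ∀ {m n} → n ℕ.< m → m ℕ.∸ n ≡ suc (m ℕ.∸ suc n)
m∸n≡1+m∸1+n {suc m} {zero}  _         = refl
m∸n≡1+m∸1+n {suc m} {suc n} (s≤s n<m) = m∸n≡1+m∸1+n n<m

-- Cantor pairing: unpair walks each diagonal a + b = s in increasing a.
triangle : ℕ → ℕ
triangle zero    = zero
triangle (suc s) = suc (triangle s ℕ.+ s)

pair : ℕ × ℕ → ℕ
pair (a , b) = triangle (a ℕ.+ b) ℕ.+ a

next : ℕ × ℕ → ℕ × ℕ
next (a , suc b) = suc a , b
next (a , zero)  = zero , suc a

unpair : ℕ → ℕ × ℕ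
unpair zero    = 0 , 0
unpair (suc n) = next (unpair n)

unpair-diagonal : ∀ s a → a ℕ.≤ s → unpair (triangle s ℕ.+ a) ≡ (a , s ℕ.∸ a)
unpair-diagonal zero    zero    _ = refl
unpair-diagonal (suc s) zero    _
  rewrite ℕ.+-identityʳ (triangle s ℕ.+ s) | unpair-diagonal s s ℕ.≤-refl | n∸n≡0 s = refl
unpair-diagonal s       (suc a) a<s
  rewrite ℕ.+-suc (triangle s) a | unpair-diagonal s a (ℕ.<⇒≤ a<s) | m∸n≡1+m∸1+n a<s = refl

unpair-pair : ∀ p → unpair (pair p) ≡ p
unpair-pair (a , b) rewrite unpair-diagonal (a ℕ.+ b) a (m≤m+n a b) | m+n∸m≡n a b = refl

fromSigned : ℕ × ℕ → ℤ
fromSigned (zero  , n) = + n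
fromSigned (suc _ , n) = -[1+ n ]

encodeℤ : ℤ → ℕ
encodeℤ (+ n)    = pair (0 , n)
encodeℤ -[1+ n ] = pair (1 , n)

decodeℤ : ℕ → ℤ
decodeℤ = fromSigned ∘ unpair

decodeℤ-encodeℤ : ∀ i → decodeℤ (encodeℤ i) ≡ i
decodeℤ-encodeℤ (+ n)    = cong fromSigned (unpair-pair (0 , n))
decodeℤ-encodeℤ -[1+ n ] = cong fromSigned (unpair-pair (1 , n))

i<1+∣i∣ : ∀ i → i < + suc ∣ i ∣
i<1+∣i∣ (+ n)    = +<+ ℕ.≤-refl
i<1+∣i∣ -[1+ n ] = -<+

Interval : Set
Interval = ℤ × ℤ

-- A pair (a , b) stands for the interval [a , a ⊔ b]; pairs with b < a are
-- points, so no invariant needs to be carried along.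
start end : Interval → ℤ
start = proj₁
end (a , b) = a ⊔ b

start≤end : ∀ x → start x ≤ end x
start≤end (a , b) = i≤i⊔j a b

point : ℤ → Interval
point i = i , i

end-point : ∀ i → end (point i) ≡ i
end-point = ⊔-idem

infix 4 _≺_
_≺_ : Interval → Interval → Set
x ≺ y = end x < start y

opaque
  infix 5 _⌢_
  _⌢_ : Interval → Interval → Maybe Interval
  x ⌢ y with end x <? start y
  ... | yes _ = just (start x , end y)
  ... | no  _ = nothing

  ⌢-defined : ∀ {x y} → x ≺ y → x ⌢ y ≡ just (start x , end y)
  ⌢-defined {x} {y} x≺y with end x <? start y
  ... | yes _   = refl
  ... | no  x⊀y = contradiction x≺y x⊀y

  ⌢-undefined : ∀ {x y} → ¬ x ≺ y → x ⌢ y ≡ nothing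
  ⌢-undefined {x} {y} x⊀y with end x <? start y
  ... | yes x≺y = contradiction x≺y x⊀y
  ... | no  _   = refl

  ⌢-inversion : ∀ {x y v} → x ⌢ y ≡ just v → x ≺ y × v ≡ (start x , end y)
  ⌢-inversion {x} {y} e with end x <? start y
  ⌢-inversion refl | yes x≺y = x≺y , refl

end-⌢ : ∀ {x y} → x ≺ y → end (start x , end y) ≡ end y
end-⌢ {x} {y} x≺y =
  i≤j⇒i⊔j≡j (<⇒≤ (≤-<-trans (start≤end x) (<-≤-trans x≺y (start≤end y))))

⌢-assoc : ∀ x y z → (x ⌢ y >>= _⌢ z) ≡ (y ⌢ z >>= x ⌢_)
⌢-assoc x y z with end x <? start y | end y <? start z
... | yes x≺y | yes y≺z = begin
  (x ⌢ y >>= _⌢ z)                        ≡⟨ cong (_>>= _⌢ z) (⌢-defined x≺y) ⟩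
  (start x , end y) ⌢ z                   ≡⟨ ⌢-defined (subst (_< start z) (sym (end-⌢ x≺y)) y≺z) ⟩
  just (start x , end z)                  ≡⟨ cong (just ∘ (start x ,_)) (sym (end-⌢ y≺z)) ⟩
  just (start x , end (start y , end z))  ≡⟨ sym (⌢-defined x≺y) ⟩
  x ⌢ (start y , end z)                   ≡⟨ cong (_>>= x ⌢_) (sym (⌢-defined y≺z)) ⟩
  (y ⌢ z >>= x ⌢_)                        ∎
  where open ≡-Reasoning
... | yes x≺y | no y⊀z
  rewrite ⌢-defined {y = y} x≺y | ⌢-undefined {y = z} y⊀z
  = ⌢-undefined (y⊀z ∘ subst (_< start z) (end-⌢ x≺y))
... | no x⊀y | yes y≺z
  rewrite ⌢-undefined {y = y} x⊀y | ⌢-defined {y = z} y≺z = sym (⌢-undefined x⊀y)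
... | no x⊀y | no y⊀z
  rewrite ⌢-undefined {y = y} x⊀y | ⌢-undefined {y = z} y⊀z = refl

intervals : PartialSemigroup
intervals = record
  { Carrier           = Interval
  ; _*_               = _⌢_
  ; somewhere-defined = point 0ℤ , point (+ 1) , _ , ⌢-defined (+<+ (s≤s z≤n))
  ; assoc             = ⌢-assoc
  }

encode : Interval → ℕ
encode (i , j) = pair (encodeℤ i , encodeℤ j)

decode : ℕ → Interval
decode = Product.map decodeℤ decodeℤ ∘ unpair

decode-encode : ∀ x → decode (encode x) ≡ x
decode-encode (i , j) =
  trans (cong (Product.map decodeℤ decodeℤ) (unpair-pair (encodeℤ i , encodeℤ j)))
        (cong₂ _,_ (decodeℤ-encodeℤ i) (decodeℤ-encodeℤ j))

intervals-countable : Countable intervals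
intervals-countable =
  encode , inverseʳ⇒injective encode (strictlyInverseʳ⇒inverseʳ {f⁻¹ = decode} encode decode-encode)

prod-∷ : ∀ x y ys {v} → prod intervals (x ∷ y ∷ ys) ≡ just v →
  Σ Interval λ w → prod intervals (y ∷ ys) ≡ just w × x ⌢ w ≡ just v
prod-∷ x y ys e with prod intervals (y ∷ ys)
... | just w = w , refl , e

prod-start : ∀ x xs {v} → prod intervals (x ∷ xs) ≡ just v → start v ≡ start x
prod-start x []       refl = refl
prod-start x (y ∷ ys) e with prod-∷ x y ys e
... | _ , _ , x⌢w = cong start (proj₂ (⌢-inversion x⌢w))

prod-∷⇒≺ : ∀ x y ys {v} → prod intervals (x ∷ y ∷ ys) ≡ just v → end x < start y
prod-∷⇒≺ x y ys e with prod-∷ x y ys e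
... | _ , ys-w , x⌢w = subst (end x <_) (prod-start y ys ys-w) (proj₁ (⌢-inversion x⌢w))

prod-chain : ∀ x xs → Linked _≺_ (x ∷ xs) →
  Σ Interval λ u → prod intervals (x ∷ xs) ≡ just u × start u ≡ start x
prod-chain x []       [-] = x , refl , refl
prod-chain x (y ∷ ys) (x≺y ∷ chain) with prod-chain y ys chain
... | u , e , u-start rewrite e =
  (start x , end u) , ⌢-defined (subst (end x <_) (sym u-start) x≺y) , refl

bound : List Interval → ℕ
bound = foldr (λ x n → suc ∣ end x ∣ ℕ.⊔ n) 0

end<bound : ∀ xs → All (λ x → end x < + bound xs) xs
end<bound []       = []
end<bound (x ∷ xs) =
  <-≤-trans (i<1+∣i∣ (end x)) (+≤+ (ℕ.m≤m⊔n (suc ∣ end x ∣) (bound xs))) ∷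
  All.map (λ lt → <-≤-trans lt (+≤+ (ℕ.m≤n⊔m (suc ∣ end x ∣) (bound xs)))) (end<bound xs)

bound≤start⇒∈σ : ∀ F y → + bound (toList F) ≤ start y → _∈σ_ intervals y F
bound≤start⇒∈σ F y le = All.map (λ lt → _ , ⌢-defined (<-≤-trans lt le)) (end<bound (toList F))

intervals-adequate : IsAdequate intervals
intervals-adequate F = point (+ bound (toList F)) , bound≤start⇒∈σ F _ ≤-refl

shifted : ℕ → ℕ → Interval
shifted r t = point (t ⊖ r)

shifted-below : ∀ {r t} → t ℕ.≤ r → t ⊖ r ≤ 0ℤ
shifted-below {r} {t} t≤r = subst (t ⊖ r ≤_) (n⊖n≡0 r) (⊖-monoˡ-≤ r t≤r)

shifted-beyond : ∀ {n r t} → n ℕ.+ r ℕ.≤ t → + n ≤ t ⊖ r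
shifted-beyond {n} le rewrite ⊖-≥ (m+n≤o⇒n≤o n le) = +≤+ (m+n≤o⇒m≤o∸n n le)

shifted-≺ : ∀ r {s t} → s ℕ.< t → shifted r s ≺ shifted r t
shifted-≺ r {s} s<t = subst (_< _) (sym (end-point (s ⊖ r))) (⊖-monoˡ-< r s<t)

prod-shifted : ∀ r t ts → Linked ℕ._<_ (t ∷ ts) →
  Σ Interval λ u → prod intervals (map (shifted r) (t ∷ ts)) ≡ just u × start u ≡ t ⊖ r
prod-shifted r t ts increasing =
  prod-chain (shifted r t) (map (shifted r) ts) (map⁺ (Linked.map (shifted-≺ r) increasing))

shifted-adequate : ∀ r → IsAdequateSeq intervals (shifted r)
shifted-adequate r = defined , eventually-∈σ
  where
  defined : (H : FinSubsetℕ intervals) → Defined (∏ intervals H (shifted r))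
  defined (fin (t ∷ ts) _ increasing) =
    let u , e , _ = prod-shifted r t ts increasing in u , e

  eventually-∈σ : (F : List⁺ Interval) → Σ ℕ λ m → (H : FinSubsetℕ intervals) →
    All (m ℕ.≤_) (elems H) →
    Σ Interval λ v → (∏ intervals H (shifted r) ≡ just v) × _∈σ_ intervals v F
  eventually-∈σ F = bound (toList F) ℕ.+ r , λ where
    (fin (t ∷ ts) _ increasing) (m≤t ∷ _) →
      let u , e , u-start = prod-shifted r t ts increasing
      in u , e , bound≤start⇒∈σ F u (subst (_ ≤_) (sym u-start) (shifted-beyond m≤t))

prod-through-shifted<0 : ∀ {r t} a ys {v} → t ℕ.≤ r →
  prod intervals (a ∷ shifted r t ∷ ys) ≡ just v → start v < 0ℤ
prod-through-shifted<0 {r} {t} a ys {v} t≤r e = begin-strict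
  start v  ≡⟨ prod-start a (shifted r t ∷ ys) e ⟩
  start a  ≤⟨ start≤end a ⟩
  end a    <⟨ prod-∷⇒≺ a (shifted r t) ys e ⟩
  t ⊖ r    ≤⟨ shifted-below t≤r ⟩
  0ℤ       ∎
  where open ≤-Reasoning hiding (start)

intervals-not-1-CR : ¬ IsKCR intervals 1 (λ _ → ⊤)
intervals-not-1-CR 1-CR with 1-CR (point 0ℤ ∷ [])
... | r , witness with witness (shifted r ∷ []) (s≤s z≤n) (s≤s z≤n) (shifted-adequate r ∷ [])
... | suc _ , _ , a ∷ as@(_ ∷ _) , _ ∷ ts , _ , t≤r ∷ _ , (_ , e , _ , (_ , 0⌢v) ∷ []) ∷ [] =
  <-asym (proj₁ (⌢-inversion 0⌢v)) (prod-through-shifted<0 a (word intervals as ts (shifted r)) t≤r e)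

theorem2p10 : Σ PartialSemigroup λ P →
    Countable P × IsAdequate P × ¬ IsKCR P 1 (λ _ → ⊤)
theorem2p10 = intervals , intervals-countable , intervals-adequate , intervals-not-1-CR
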